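{- Let $\xi,\zeta\in\mathbb{Q}\setminus\{0,1,-1\}$ with $\xi\neq\zeta$ be such that $\xi\zeta$ and $(1-\xi^2)(1-\zeta^2)$ are both squares of rational numbers. Then these give a nearly-perfect cuboid in which the only face diagonal not required to be rational is $d_{ab}$: namely, choosing rationals $\alpha,\beta$ with $\alpha^2=\xi\zeta$, $\beta^2=\xi/\zeta$, and setting $$\frac{d_s}{a}=\frac{1+\alpha^2}{2\alpha},\quad \frac{d_{bc}}{a}=\frac{1-\alpha^2}{2\alpha},\quad \frac{d_{ac}}{a}=\frac{1+\beta^2}{2\beta},\quad \frac{c}{a}=\frac{1-\beta^2}{2\beta},\quad \frac{b}{a}=\sqrt{\frac{(1-\xi^2)(1-\zeta^2)}{4\xi\zeta}},$$ all of these ratios are rational, so that (taking $a$ rational) the edges $a,b,c$, the face diagonals $d_{bc}=\sqrt{b^2+c^2}$, $d_{ac}=\sqrt{a^2+c^2}$ and the space diagonal $d_s=\sqrt{a^2+b^2+c^2}$ are all rational.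
   Context: A cuboid has edges $a,b,c$, face diagonals $d_{ab}=\sqrt{a^2+b^2}$, $d_{bc}=\sqrt{b^2+c^2}$, $d_{ac}=\sqrt{a^2+c^2}$ and space diagonal $d_s=\sqrt{a^2+b^2+c^2}$. A nearly-perfect cuboid (of the type considered) is one in which all of these seven quantities except one face diagonal are rational. -}

module Defs where

open import Data.Rational using (ℚ; _+_; _*_)
open import Data.Rational.Base using (0ℚ)
open import Data.Product using (Σ-syntax; _×_)
open import Relation.Binary.PropositionalEquality using (_≡_; _≢_)

IsSquare : ℚ → Set
IsSquare q = Σ[ r ∈ ℚ ] r * r ≡ q

-- Here the diagonals are given explicitly as rationals whose squares are
-- the required sums of squares.
NearlyPerfectAB : (a b c dbc dac ds : ℚ) → Set
NearlyPerfectAB a b c dbc dac ds =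
  a ≢ 0ℚ × b ≢ 0ℚ × c ≢ 0ℚ ×
  dbc * dbc ≡ b * b + c * c ×
  dac * dac ≡ a * a + c * c ×
  ds * ds ≡ a * a + b * b + c * c

-- For every t ≠ 0 the pair ((1 + t²)/2t, (1 − t²)/2t) satisfies X² = 1 + Y²
-- (legs 2t and 1 − t², hypotenuse 1 + t², rescaled).  Taking t = β gives
-- d_ac² = a² + c², and taking t = α gives d_s² = a² + d_bc², so everything
-- reduces to d_bc² = b² + c².  Using α² = ξζ and β² = ξ/ζ, all three squared
-- ratios have the common factor 1/(4ξζ), and what remains is the identity
--   (1 − ξζ)² = (1 − ξ²)(1 − ζ²) + (ζ − ξ)².
module Submission where

open import Defs
open import Data.Rational using (ℚ; NonZero; _+_; _*_; _-_; -_; 1/_; _÷_; 0ℚ; 1ℚ; ½)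
open import Data.Product using (Σ-syntax; _×_; _,_)
open import Relation.Binary.PropositionalEquality
  using (_≡_; _≢_; refl; sym; trans; cong; cong₂; subst; module ≡-Reasoning)
open import Function using (_∘_)
open import Algebra.Bundles using (CommutativeMonoid)
open import Data.Rational.Properties
  using (1≢0; *-comm; *-assoc; +-assoc; *-identityˡ; *-identityʳ; *-zeroˡ; +-identityʳ;
         *-inverseˡ; *-inverseʳ; nonZero⇒1/nonZero;
         +-0-group; *-1-commutativeMonoid; heytingCommutativeRing)
open import Algebra.Properties.Group +-0-group using (x∙y⁻¹≈ε⇒x≈y)
open import Algebra.Properties.CommutativeSemigroup
  (CommutativeMonoid.commutativeSemigroup *-1-commutativeMonoid) using (interchange)
-- The apartness of ℚ's Heyting ring is _≢_, so this is: p ≢ 0ℚ → q ≢ 0ℚ → p * q ≢ 0ℚ.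
open import Algebra.Apartness.Properties.HeytingCommutativeRing heytingCommutativeRing
  using (x#0y#0→xy#0)
open import Data.Rational.Solver using (module +-*-Solver)
open +-*-Solver using (solve; _:=_; con; _:+_; _:*_; _:-_)

open ≡-Reasoning

leg hyp : (t : ℚ) .{{_ : NonZero t}} → ℚ
leg t = (1ℚ - t * t) * ½ * 1/ t
hyp t = (1ℚ + t * t) * ½ * 1/ t

nonZero⇒≢0 : ∀ p .{{_ : NonZero p}} → p ≢ 0ℚ
nonZero⇒≢0 p p≡0 = 1≢0 (begin
  1ℚ         ≡⟨ sym (*-inverseʳ p) ⟩
  p * 1/ p   ≡⟨ cong (_* 1/ p) p≡0 ⟩
  0ℚ * 1/ p  ≡⟨ *-zeroˡ (1/ p) ⟩
  0ℚ         ∎)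

square≢0⇒≢0 : ∀ p → p * p ≢ 0ℚ → p ≢ 0ℚ
square≢0⇒≢0 p p²≢0 refl = p²≢0 refl

inverse-unique : ∀ p {q r} → p * q ≡ 1ℚ → p * r ≡ 1ℚ → q ≡ r
inverse-unique p {q} {r} pq≡1 pr≡1 = begin
  q            ≡⟨ sym (*-identityˡ q) ⟩
  1ℚ * q       ≡⟨ cong (_* q) (trans (sym pr≡1) (*-comm p r)) ⟩
  r * p * q    ≡⟨ *-assoc r p q ⟩
  r * (p * q)  ≡⟨ cong (r *_) pq≡1 ⟩
  r * 1ℚ       ≡⟨ *-identityʳ r ⟩
  r            ∎

*-cancelˡ-1/ : ∀ p .{{_ : NonZero p}} q → p * q * 1/ p ≡ q
*-cancelˡ-1/ p q = begin
  p * q * 1/ p    ≡⟨ cong (_* 1/ p) (*-comm p q) ⟩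
  q * p * 1/ p    ≡⟨ *-assoc q p (1/ p) ⟩
  q * (p * 1/ p)  ≡⟨ cong (q *_) (*-inverseʳ p) ⟩
  q * 1ℚ          ≡⟨ *-identityʳ q ⟩
  q               ∎

1-x²≢0 : ∀ x → x ≢ 1ℚ → x ≢ - 1ℚ → 1ℚ - x * x ≢ 0ℚ
1-x²≢0 x x≢1 x≢-1 = subst (_≢ 0ℚ) (sym (factor x))
  (x#0y#0→xy#0 (x≢1 ∘ sym ∘ x∙y⁻¹≈ε⇒x≈y 1ℚ x) (x≢-1 ∘ x∙y⁻¹≈ε⇒x≈y x (- 1ℚ)))
  where
  factor : ∀ x → 1ℚ - x * x ≡ (1ℚ - x) * (x - - 1ℚ)
  factor = solve 1 (λ x → con 1ℚ :- x :* x := (con 1ℚ :- x) :* (x :- con (- 1ℚ))) refl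

1-p÷q≢0 : ∀ p q .{{_ : NonZero q}} → p ≢ q → 1ℚ - p ÷ q ≢ 0ℚ
1-p÷q≢0 p q p≢q 1-p÷q≡0 = p≢q (inverse-unique (1/ q) 1/q*p≡1 (*-inverseˡ q))
  where
  1/q*p≡1 : 1/ q * p ≡ 1ℚ
  1/q*p≡1 = trans (*-comm (1/ q) p) (sym (x∙y⁻¹≈ε⇒x≈y 1ℚ (p ÷ q) 1-p÷q≡0))

half-ratio≢0 : ∀ t .{{_ : NonZero t}} {s} → s ≢ 0ℚ → s * ½ * 1/ t ≢ 0ℚ
half-ratio≢0 t s≢0 =
  x#0y#0→xy#0 (x#0y#0→xy#0 s≢0 (λ ())) (nonZero⇒≢0 (1/ t) {{nonZero⇒1/nonZero t}})

1/-square : ∀ t .{{_ : NonZero t}} p q p′ q′ →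
            t * t ≡ p * q → p * p′ ≡ 1ℚ → q * q′ ≡ 1ℚ → 1/ t * 1/ t ≡ p′ * q′
1/-square t p q p′ q′ t²≡pq pp′≡1 qq′≡1 = inverse-unique (t * t) t²*1/t²≡1 t²*p′q′≡1
  where
  t²*1/t²≡1 : t * t * (1/ t * 1/ t) ≡ 1ℚ
  t²*1/t²≡1 = begin
    t * t * (1/ t * 1/ t)    ≡⟨ interchange t t (1/ t) (1/ t) ⟩
    t * 1/ t * (t * 1/ t)    ≡⟨ cong₂ _*_ (*-inverseʳ t) (*-inverseʳ t) ⟩
    1ℚ                       ∎
  t²*p′q′≡1 : t * t * (p′ * q′) ≡ 1ℚ
  t²*p′q′≡1 = begin
    t * t * (p′ * q′)        ≡⟨ cong (_* (p′ * q′)) t²≡pq ⟩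
    p * q * (p′ * q′)        ≡⟨ interchange p q p′ q′ ⟩
    p * p′ * (q * q′)        ≡⟨ cong₂ _*_ pp′≡1 qq′≡1 ⟩
    1ℚ                       ∎

half-ratio-square : ∀ t .{{_ : NonZero t}} p q p′ q′ s →
                    t * t ≡ p * q → p * p′ ≡ 1ℚ → q * q′ ≡ 1ℚ →
                    (s * ½ * 1/ t) * (s * ½ * 1/ t) ≡ s * s * ½ * ½ * p′ * q′
half-ratio-square t p q p′ q′ s t²≡pq pp′≡1 qq′≡1 = begin
  (s * ½ * 1/ t) * (s * ½ * 1/ t)  ≡⟨ expand s (1/ t) ⟩
  s * s * ½ * ½ * (1/ t * 1/ t)    ≡⟨ cong (s * s * ½ * ½ *_) (1/-square t p q p′ q′ t²≡pq pp′≡1 qq′≡1) ⟩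
  s * s * ½ * ½ * (p′ * q′)        ≡⟨ sym (*-assoc (s * s * ½ * ½) p′ q′) ⟩
  s * s * ½ * ½ * p′ * q′          ∎
  where
  expand : ∀ s u → (s * ½ * u) * (s * ½ * u) ≡ s * s * ½ * ½ * (u * u)
  expand = solve 2 (λ s u → (s :* con ½ :* u) :* (s :* con ½ :* u)
                            := s :* s :* con ½ :* con ½ :* (u :* u)) refl

hyp²≡1+leg² : ∀ t .{{_ : NonZero t}} → hyp t * hyp t ≡ 1ℚ * 1ℚ + leg t * leg t
hyp²≡1+leg² t = begin
  hyp t * hyp t                            ≡⟨ identity t (1/ t) ⟩
  t * 1/ t * (t * 1/ t) + leg t * leg t    ≡⟨ cong (λ e → e * e + leg t * leg t) (*-inverseʳ t) ⟩
  1ℚ * 1ℚ + leg t * leg t                  ∎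
  where
  identity : ∀ t u → ((1ℚ + t * t) * ½ * u) * ((1ℚ + t * t) * ½ * u)
                   ≡ (t * u) * (t * u) + ((1ℚ - t * t) * ½ * u) * ((1ℚ - t * t) * ½ * u)
  identity = solve 2 (λ t u →
    ((con 1ℚ :+ t :* t) :* con ½ :* u) :* ((con 1ℚ :+ t :* t) :* con ½ :* u)
    := (t :* u) :* (t :* u) :+ ((con 1ℚ :- t :* t) :* con ½ :* u) :* ((con 1ℚ :- t :* t) :* con ½ :* u)) refl

scale-pythagorean : ∀ a {x y z} → x * x ≡ y * y + z * z →
                    (a * x) * (a * x) ≡ (a * y) * (a * y) + (a * z) * (a * z)
scale-pythagorean a {x} {y} {z} x²≡y²+z² = begin
  (a * x) * (a * x)                    ≡⟨ square-* a x ⟩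
  a * a * (x * x)                      ≡⟨ cong (a * a *_) x²≡y²+z² ⟩
  a * a * (y * y + z * z)              ≡⟨ distrib a y z ⟩
  (a * y) * (a * y) + (a * z) * (a * z) ∎
  where
  square-* : ∀ a x → (a * x) * (a * x) ≡ a * a * (x * x)
  square-* = solve 2 (λ a x → (a :* x) :* (a :* x) := a :* a :* (x :* x)) refl
  distrib : ∀ a y z → a * a * (y * y + z * z) ≡ (a * y) * (a * y) + (a * z) * (a * z)
  distrib = solve 3 (λ a y z → a :* a :* (y :* y :+ z :* z)
                               := (a :* y) :* (a :* y) :+ (a :* z) :* (a :* z)) refl

scaled-hyp² : ∀ a t .{{_ : NonZero t}} → (a * hyp t) * (a * hyp t) ≡ a * a + (a * leg t) * (a * leg t)
scaled-hyp² a t = subst (λ e → (a * hyp t) * (a * hyp t) ≡ e * e + (a * leg t) * (a * leg t))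
  (*-identityʳ a) (scale-pythagorean a (hyp²≡1+leg² t))

vanishing-residue : ∀ t .{{_ : NonZero t}} e r → e + (1ℚ - t * 1/ t) * r ≡ e
vanishing-residue t e r = begin
  e + (1ℚ - t * 1/ t) * r  ≡⟨ cong (λ w → e + (1ℚ - w) * r) (*-inverseʳ t) ⟩
  e + 0ℚ * r               ≡⟨ cong (e +_) (*-zeroˡ r) ⟩
  e + 0ℚ                   ≡⟨ +-identityʳ e ⟩
  e                        ∎

module _ (ξ ζ : ℚ) .{{_ : NonZero ξ}} .{{_ : NonZero ζ}} where

  over4ξζ : ℚ → ℚ
  over4ξζ e = e * ½ * ½ * 1/ ξ * 1/ ζ

  leg²-of-product : ∀ α .{{_ : NonZero α}} → α * α ≡ ξ * ζ →
                    leg α * leg α ≡ over4ξζ ((1ℚ - ξ * ζ) * (1ℚ - ξ * ζ))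
  leg²-of-product α α²≡ξζ = begin
    leg α * leg α
      ≡⟨ half-ratio-square α ξ ζ (1/ ξ) (1/ ζ) (1ℚ - α * α) α²≡ξζ (*-inverseʳ ξ) (*-inverseʳ ζ) ⟩
    over4ξζ ((1ℚ - α * α) * (1ℚ - α * α))
      ≡⟨ cong (λ s → over4ξζ ((1ℚ - s) * (1ℚ - s))) α²≡ξζ ⟩
    over4ξζ ((1ℚ - ξ * ζ) * (1ℚ - ξ * ζ)) ∎

  leg²-of-quotient : ∀ β .{{_ : NonZero β}} → β * β ≡ ξ ÷ ζ →
                     leg β * leg β ≡ over4ξζ ((ζ - ξ) * (ζ - ξ))
  leg²-of-quotient β β²≡ξ÷ζ = begin
    leg β * leg β
      ≡⟨ half-ratio-square β ξ (1/ ζ) (1/ ξ) ζ (1ℚ - β * β) β²≡ξ÷ζ (*-inverseʳ ξ) (*-inverseˡ ζ) ⟩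
    (1ℚ - β * β) * (1ℚ - β * β) * ½ * ½ * 1/ ξ * ζ
      ≡⟨ cong (λ s → (1ℚ - s) * (1ℚ - s) * ½ * ½ * 1/ ξ * ζ) β²≡ξ÷ζ ⟩
    (1ℚ - ξ * 1/ ζ) * (1ℚ - ξ * 1/ ζ) * ½ * ½ * 1/ ξ * ζ
      ≡⟨ identity ξ ζ (1/ ξ) (1/ ζ) ⟩
    over4ξζ ((ζ - ξ) * (ζ - ξ)) + (1ℚ - ζ * 1/ ζ) * ((ζ - ξ * ξ * 1/ ζ) * ½ * ½ * 1/ ξ)
      ≡⟨ vanishing-residue ζ (over4ξζ ((ζ - ξ) * (ζ - ξ))) ((ζ - ξ * ξ * 1/ ζ) * ½ * ½ * 1/ ξ) ⟩
    over4ξζ ((ζ - ξ) * (ζ - ξ)) ∎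
    where
    identity : ∀ ξ ζ x z → (1ℚ - ξ * z) * (1ℚ - ξ * z) * ½ * ½ * x * ζ
                         ≡ (ζ - ξ) * (ζ - ξ) * ½ * ½ * x * z + (1ℚ - ζ * z) * ((ζ - ξ * ξ * z) * ½ * ½ * x)
    identity = solve 4 (λ ξ ζ x z →
      (con 1ℚ :- ξ :* z) :* (con 1ℚ :- ξ :* z) :* con ½ :* con ½ :* x :* ζ
      := (ζ :- ξ) :* (ζ :- ξ) :* con ½ :* con ½ :* x :* z
         :+ (con 1ℚ :- ζ :* z) :* ((ζ :- ξ :* ξ :* z) :* con ½ :* con ½ :* x)) refl

  half-ratio²-of-root : ∀ α γ .{{_ : NonZero α}} → α * α ≡ ξ * ζ → γ * γ ≡ (1ℚ - ξ * ξ) * (1ℚ - ζ * ζ) →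
                        (γ * ½ * 1/ α) * (γ * ½ * 1/ α) ≡ over4ξζ ((1ℚ - ξ * ξ) * (1ℚ - ζ * ζ))
  half-ratio²-of-root α γ α²≡ξζ γ²≡Γ =
    trans (half-ratio-square α ξ ζ (1/ ξ) (1/ ζ) γ α²≡ξζ (*-inverseʳ ξ) (*-inverseʳ ζ)) (cong over4ξζ γ²≡Γ)

  face-diagonal-bc-ratio : ∀ α β γ .{{_ : NonZero α}} .{{_ : NonZero β}} →
             α * α ≡ ξ * ζ → β * β ≡ ξ ÷ ζ → γ * γ ≡ (1ℚ - ξ * ξ) * (1ℚ - ζ * ζ) →
             leg α * leg α ≡ (γ * ½ * 1/ α) * (γ * ½ * 1/ α) + leg β * leg β
  face-diagonal-bc-ratio α β γ α²≡ξζ β²≡ξ÷ζ γ²≡Γ = begin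
    leg α * leg α                                          ≡⟨ leg²-of-product α α²≡ξζ ⟩
    over4ξζ ((1ℚ - ξ * ζ) * (1ℚ - ξ * ζ))                   ≡⟨ identity ξ ζ (1/ ξ) (1/ ζ) ⟩
    over4ξζ ((1ℚ - ξ * ξ) * (1ℚ - ζ * ζ)) + over4ξζ ((ζ - ξ) * (ζ - ξ))
      ≡⟨ cong₂ _+_ (sym (half-ratio²-of-root α γ α²≡ξζ γ²≡Γ)) (sym (leg²-of-quotient β β²≡ξ÷ζ)) ⟩
    (γ * ½ * 1/ α) * (γ * ½ * 1/ α) + leg β * leg β        ∎
    where
    identity : ∀ ξ ζ x z → (1ℚ - ξ * ζ) * (1ℚ - ξ * ζ) * ½ * ½ * x * z
                         ≡ (1ℚ - ξ * ξ) * (1ℚ - ζ * ζ) * ½ * ½ * x * z + (ζ - ξ) * (ζ - ξ) * ½ * ½ * x * z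
    identity = solve 4 (λ ξ ζ x z →
      (con 1ℚ :- ξ :* ζ) :* (con 1ℚ :- ξ :* ζ) :* con ½ :* con ½ :* x :* z
      := (con 1ℚ :- ξ :* ξ) :* (con 1ℚ :- ζ :* ζ) :* con ½ :* con ½ :* x :* z
         :+ (ζ :- ξ) :* (ζ :- ξ) :* con ½ :* con ½ :* x :* z) refl

theorem2 : (ξ ζ : ℚ) .{{_ : NonZero ξ}} .{{_ : NonZero ζ}} →
           ξ ≢ 1ℚ → ξ ≢ - 1ℚ → ζ ≢ 1ℚ → ζ ≢ - 1ℚ → ξ ≢ ζ →
           IsSquare (ξ * ζ) →
           IsSquare ((1ℚ - ξ * ξ) * (1ℚ - ζ * ζ)) →
           (α β : ℚ) .{{_ : NonZero α}} .{{_ : NonZero β}} →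
           α * α ≡ ξ * ζ → β * β ≡ ξ ÷ ζ →
           (a : ℚ) .{{_ : NonZero a}} →
           Σ[ b ∈ ℚ ]
             ((b * 1/ a) * (b * 1/ a)
                ≡ (1ℚ - ξ * ξ) * (1ℚ - ζ * ζ) * ½ * ½ * 1/ ξ * 1/ ζ
             × NearlyPerfectAB a b
                 (a * ((1ℚ - β * β) * ½ * 1/ β))
                 (a * ((1ℚ - α * α) * ½ * 1/ α))
                 (a * ((1ℚ + β * β) * ½ * 1/ β))
                 (a * ((1ℚ + α * α) * ½ * 1/ α)))
-- The square root of ξζ is supplied as α.
theorem2 ξ ζ ξ≢1 ξ≢-1 ζ≢1 ζ≢-1 ξ≢ζ _ (γ , γ²≡Γ) α β α²≡ξζ β²≡ξ÷ζ a =
  a * B , b-ratio , nonZero⇒≢0 a , b≢0 , c≢0 , d-bc , scaled-hyp² a β , d-s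
  where
  B : ℚ
  B = γ * ½ * 1/ α

  b-ratio : (a * B * 1/ a) * (a * B * 1/ a) ≡ over4ξζ ξ ζ ((1ℚ - ξ * ξ) * (1ℚ - ζ * ζ))
  b-ratio = trans (cong (λ e → e * e) (*-cancelˡ-1/ a B)) (half-ratio²-of-root ξ ζ α γ α²≡ξζ γ²≡Γ)

  b≢0 : a * B ≢ 0ℚ
  b≢0 = x#0y#0→xy#0 (nonZero⇒≢0 a) (half-ratio≢0 α (square≢0⇒≢0 γ
          (subst (_≢ 0ℚ) (sym γ²≡Γ) (x#0y#0→xy#0 (1-x²≢0 ξ ξ≢1 ξ≢-1) (1-x²≢0 ζ ζ≢1 ζ≢-1)))))

  c≢0 : a * leg β ≢ 0ℚ
  c≢0 = x#0y#0→xy#0 (nonZero⇒≢0 a) (half-ratio≢0 β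
          (subst (λ s → 1ℚ - s ≢ 0ℚ) (sym β²≡ξ÷ζ) (1-p÷q≢0 ξ ζ ξ≢ζ)))

  d-bc : (a * leg α) * (a * leg α) ≡ (a * B) * (a * B) + (a * leg β) * (a * leg β)
  d-bc = scale-pythagorean a (face-diagonal-bc-ratio ξ ζ α β γ α²≡ξζ β²≡ξ÷ζ γ²≡Γ)

  d-s : (a * hyp α) * (a * hyp α) ≡ a * a + (a * B) * (a * B) + (a * leg β) * (a * leg β)
  d-s = begin
    (a * hyp α) * (a * hyp α)                             ≡⟨ scaled-hyp² a α ⟩
    a * a + (a * leg α) * (a * leg α)                     ≡⟨ cong (a * a +_) d-bc ⟩
    a * a + ((a * B) * (a * B) + (a * leg β) * (a * leg β)) ≡⟨ sym (+-assoc (a * a) _ _) ⟩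
    a * a + (a * B) * (a * B) + (a * leg β) * (a * leg β)   ∎
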